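{- Let $\Sigma$ be a finite alphabet and let $k,\ell>0$ be finite integers. Then: (1) the set $\{\tau_W(S): S\text{ is a set of finite } k\text{ -parameter words over }\Sigma,\ |S|=\ell,\ W\text{ is a minimal envelope of }S\}$ is finite; and (2) for every finite set $S$ of finite $k$-parameter words over $\Sigma$ and any two minimal envelopes $W,W'$ of $S$, $\tau_W(S)=\tau_{W'}(S)$.
   Context: Given a finite alphabet $\Sigma$ and $k\in\omega\cup\{\omega\}$, a $k$-parameter word is a (finite or infinite) string $W$ over $\Sigma\cup\{\lambda_i: 0\le i<k\}$ (the $\lambda_i$ are new symbols, called parameters) which contains each $\lambda_i$, $0\le i<k$, such that for every $1\le j<k$ the first occurrence of $\lambda_j$ is after the first occurrence of $\lambda_{j-1}$. $|W|$ is the length of $W$ and $W_j$ its letter at index $j$ (indices start at $0$). If $W$ is an $n$-parameter word and $U$ a parameter word of length $m\le n$, $W(U)$ is obtained from $W$ by replacing each occurrence of $\lambda_i$, $0\le i<m$, by $U_i$ and truncating just before the first occurrence of $\lambda_m$ in $W$ (no truncation if $m=n$); for a set $T$ of parameter words, $W(T)=\{W(U):U\in T\}$. An envelope of a set $S$ of parameter words over $\Sigma$ is a parameter word $W$ over $\Sigma$ such that for every $U\in S$ there exists a parameter word $U'$ with $W(U')=U$; it is minimal if no envelope of $S$ has fewer parameters. For an envelope $W$ of $S$, the embedding type $\tau_W(S)$ is the set $T$ of parameter words such that $W(T)=S$. -}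

module Defs where

open import Data.Nat using (ℕ; zero; suc; _<_; _≤_; _<ᵇ_)
open import Data.Nat.Properties using () renaming (_≟_ to _≟ℕ_)
open import Data.Fin using (Fin)
open import Data.Fin.Properties using () renaming (_≟_ to _≟F_)
open import Data.Sum using (_⊎_; inj₁; inj₂)
open import Data.Sum.Properties using (≡-dec)
open import Data.List using (List; []; _∷_; length; map; take)
open import Data.List.Membership.Propositional using (_∈_)
open import Data.Product using (Σ; _×_; ∃)
import Data.Maybe
open import Data.Bool using (if_then_else_)
open import Relation.Nullary using (yes; no)
open import Relation.Binary.PropositionalEquality using (_≡_)
open import Function.Bundles using (_⇔_)

-- Letters of parameter words over the alphabet Σ = Fin s:
-- inj₁ a is the letter a ∈ Σ, inj₂ i is the parameter λ_i.
Letter : ℕ → Set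
Letter s = Fin s ⊎ ℕ

Word : ℕ → Set
Word s = List (Letter s)

λ′ : {s : ℕ} → ℕ → Letter s
λ′ i = inj₂ i

_≟L_ : {s : ℕ} → (x y : Letter s) → _
_≟L_ = ≡-dec _≟F_ _≟ℕ_

-- index of the first occurrence of x in w (length w if x does not occur)
firstOcc : {s : ℕ} → Letter s → Word s → ℕ
firstOcc x [] = zero
firstOcc x (y ∷ w) with x ≟L y
... | yes _ = zero
... | no _  = suc (firstOcc x w)

record IsParamWord {s : ℕ} (k : ℕ) (w : Word s) : Set where
  field
    onlyParamsBelowK : ∀ i → λ′ i ∈ w → i < k
    containsParams   : ∀ i → i < k → λ′ i ∈ w
    firstOccOrdered  : ∀ j → 1 ≤ j → j < k →
                         firstOcc (λ′ (Data.Nat.pred j)) w < firstOcc (λ′ j) w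

IsPW : {s : ℕ} → Word s → Set
IsPW w = ∃ λ k → IsParamWord k w

nth : {A : Set} → ℕ → List A → Data.Maybe.Maybe A
nth i [] = Data.Maybe.nothing
nth zero (x ∷ xs) = Data.Maybe.just x
nth (suc i) (x ∷ xs) = nth i xs

substL : {s : ℕ} → Word s → Letter s → Letter s
substL U (inj₁ a) = inj₁ a
substL U (inj₂ i) with nth i U
... | Data.Maybe.just u = u
... | Data.Maybe.nothing = inj₂ i

-- W(U) for an n-parameter word W and a parameter word U of length m ≤ n:
-- replace λ_i (i < m) by U_i and truncate just before the first
-- occurrence of λ_m (no truncation if m = n).
apply : {s : ℕ} → (n : ℕ) → Word s → Word s → Word s
apply n W U =
  map (substL U)
    (if length U <ᵇ n then take (firstOcc (λ′ (length U)) W) W else W)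

Envelope : {s : ℕ} → ℕ → Word s → List (Word s) → Set
Envelope n W S =
  IsParamWord n W ×
  (∀ u → u ∈ S → ∃ λ U → IsPW U × length U ≤ n × apply n W U ≡ u)

MinimalEnvelope : {s : ℕ} → ℕ → Word s → List (Word s) → Set
MinimalEnvelope {s} n W S =
  Envelope n W S × (∀ n′ (W′ : Word s) → Envelope n′ W′ S → n ≤ n′)

-- T (a set of parameter words, given as a predicate) satisfies W(T) = S,
-- i.e. T is the embedding type τ_W(S)
IsEmbType : {s : ℕ} → ℕ → Word s → List (Word s) → (Word s → Set) → Set
IsEmbType n W S T =
  (∀ U → T U → IsPW U × length U ≤ n) ×
  (∀ u → (u ∈ S) ⇔ (∃ λ U → T U × apply n W U ≡ u))

module Submission where

-- Call a position p forced by S if some word of S ends at p while another one is longer, or if some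
-- word reaches p and the column of S at p is neither constant nor equal to an earlier column.
-- Every envelope of S has the first occurrence of a parameter at each forced position.
-- Conversely, let W be a minimal envelope. Some word of S is as long as W, since otherwise the last
-- parameter of W could be cut off. If the first occurrence p of λ_j in W were not forced, no witness U
-- would have length j, and λ_j could be replaced by the constant letter of column p or by the
-- parameter of W at an earlier equal column; this gives an envelope with fewer parameters. So all
-- minimal envelopes of S share their first-occurrence positions and their length, and as these
-- determine U from W(U), the embedding type does not depend on W.
-- Distinct forced positions have distinct columns, and a column is a list of |S| entries from the
-- letters, the parameters λ_i (i < k) and "none". This bounds the number of parameters of a minimal
-- envelope, hence the length of the words of its embedding type, in terms of |Σ|, k and |S|.

open import Defs
open import Data.Bool using (true; false; if_then_else_)
open import Data.Empty using (⊥; ⊥-elim)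
open import Data.Fin using (Fin)
open import Data.Fin.Properties using (toℕ-injective; toℕ<n; injective⇒≤)
open import Data.List
  using (List; []; _∷_; _++_; length; lookup; map; take; upTo; allFin; cartesianProductWith; concatMap)
open import Data.List.Properties
  using (length-map; length-take; take-take; take-all; ∷-injectiveˡ; ∷-injectiveʳ)
open import Data.List.Relation.Unary.All as All using (All; []; _∷_)
open import Data.List.Relation.Unary.All.Properties using (map⁺)
open import Data.List.Relation.Unary.Any as Any using (Any; here; there; any?)
open import Data.List.Relation.Unary.Any.Properties using (lookup-index; mapWith∈⁺; mapWith∈⁻)
open import Data.List.Relation.Unary.Unique.Propositional using (Unique)
open import Data.List.Membership.Propositional using (_∈_; find; lose; mapWith∈)
open import Data.List.Membership.Propositional.Properties
  using (∈-++⁺ˡ; ∈-++⁺ʳ; ∈-map⁺; ∈-allFin; ∈-upTo⁺; ∈-cartesianProductWith⁺; ∈-concatMap⁺)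
open import Data.List.Membership.Setoid.Properties using (length-mapWith∈)
open import Data.Maybe as Maybe using (Maybe; just; nothing)
open import Data.Maybe.Properties using (just-injective)
open import Data.Nat using (ℕ; zero; suc; pred; _<_; _≤_; _<ᵇ_; _⊓_; z≤n; s≤s; _<?_; _≟_)
open import Data.Nat.Properties
open import Data.Product using (Σ; _×_; _,_; proj₁; proj₂; ∃)
open import Data.Sum using (_⊎_; inj₁; inj₂)
open import Data.Unit using (tt)
open import Function using (_∘_)
open import Function.Bundles using (_⇔_; mk⇔; Equivalence)
open import Function.Definitions using (Injective)
open import Relation.Binary using (tri<; tri≈; tri>)
open import Relation.Binary.PropositionalEquality
open import Relation.Nullary using (¬_; yes; no; ¬¬-map)
open import Relation.Nullary.Decidable using (decidable-stable)

module _ {A : Set} where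

  nth-ext : (xs ys : List A) → (∀ i → nth i xs ≡ nth i ys) → xs ≡ ys
  nth-ext []       []       _ = refl
  nth-ext []       (y ∷ ys) h with h 0
  ... | ()
  nth-ext (x ∷ xs) []       h with h 0
  ... | ()
  nth-ext (x ∷ xs) (y ∷ ys) h with h 0
  ... | refl = cong (x ∷_) (nth-ext xs ys (h ∘ suc))

  nth-just : ∀ i (xs : List A) → i < length xs → ∃ λ x → nth i xs ≡ just x
  nth-just zero    (x ∷ xs) _         = x , refl
  nth-just (suc i) (x ∷ xs) (s≤s i<n) = nth-just i xs i<n

  nth-nothing : ∀ i (xs : List A) → length xs ≤ i → nth i xs ≡ nothing
  nth-nothing i       []       _         = refl
  nth-nothing (suc i) (x ∷ xs) (s≤s n≤i) = nth-nothing i xs n≤i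

  nth-just⇒< : ∀ i (xs : List A) {x} → nth i xs ≡ just x → i < length xs
  nth-just⇒< zero    (x ∷ xs) _ = s≤s z≤n
  nth-just⇒< (suc i) (x ∷ xs) e = s≤s (nth-just⇒< i xs e)

  nth-just⇒∈ : ∀ i (xs : List A) {x} → nth i xs ≡ just x → x ∈ xs
  nth-just⇒∈ zero    (x ∷ xs) refl = here refl
  nth-just⇒∈ (suc i) (x ∷ xs) e    = there (nth-just⇒∈ i xs e)

  ∈⇒nth : ∀ (xs : List A) {x} → x ∈ xs → ∃ λ i → nth i xs ≡ just x
  ∈⇒nth (x ∷ xs) (here refl) = 0 , refl
  ∈⇒nth (x ∷ xs) (there x∈)  = let i , e = ∈⇒nth xs x∈ in suc i , e

  nth-take : ∀ i c (xs : List A) → i < c → nth i (take c xs) ≡ nth i xs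
  nth-take i       (suc c) []       _         = refl
  nth-take zero    (suc c) (x ∷ xs) _         = refl
  nth-take (suc i) (suc c) (x ∷ xs) (s≤s i<c) = nth-take i c xs i<c

  nth-take-≥ : ∀ i c (xs : List A) → c ≤ i → nth i (take c xs) ≡ nothing
  nth-take-≥ i       zero    xs       _         = refl
  nth-take-≥ i       (suc c) []       _         = refl
  nth-take-≥ (suc i) (suc c) (x ∷ xs) (s≤s c≤i) = nth-take-≥ i c xs c≤i

nth-map : ∀ {A B : Set} (f : A → B) i (xs : List A) → nth i (map f xs) ≡ Maybe.map f (nth i xs)
nth-map f i       []       = refl
nth-map f zero    (x ∷ xs) = refl
nth-map f (suc i) (x ∷ xs) = nth-map f i xs

nth-map-just⁻ : ∀ {A B : Set} (f : A → B) i (xs : List A) {y} → nth i (map f xs) ≡ just y →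
                ∃ λ x → nth i xs ≡ just x × f x ≡ y
nth-map-just⁻ f i xs e with nth i xs | trans (sym (nth-map f i xs)) e
... | just x | refl = x , refl , refl

module _ {s : ℕ} where

  firstOcc-nth : ∀ (x : Letter s) w → x ∈ w → nth (firstOcc x w) w ≡ just x
  firstOcc-nth x (y ∷ w) x∈ with x ≟L y
  ... | yes refl = refl
  firstOcc-nth x (y ∷ w) (here refl) | no x≢y = ⊥-elim (x≢y refl)
  firstOcc-nth x (y ∷ w) (there x∈)  | no _   = firstOcc-nth x w x∈

  firstOcc-minimal : ∀ (x : Letter s) w q → nth q w ≡ just x → firstOcc x w ≤ q
  firstOcc-minimal x (y ∷ w) q e with x ≟L y
  ... | yes _ = z≤n
  firstOcc-minimal x (y ∷ w) zero    refl | no x≢y = ⊥-elim (x≢y refl)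
  firstOcc-minimal x (y ∷ w) (suc q) e    | no _   = s≤s (firstOcc-minimal x w q e)

  firstOcc-unique : ∀ (x : Letter s) w p → nth p w ≡ just x → (∀ q → q < p → nth q w ≢ just x) →
                    firstOcc x w ≡ p
  firstOcc-unique x w p e earlier with <-cmp (firstOcc x w) p
  ... | tri< f<p _ _ = ⊥-elim (earlier _ f<p (firstOcc-nth x w (nth-just⇒∈ p w e)))
  ... | tri≈ _ f≡p _ = f≡p
  ... | tri> _ _ p<f = ⊥-elim (<⇒≱ p<f (firstOcc-minimal x w p e))

  firstOcc-≤-length : ∀ (x : Letter s) w → firstOcc x w ≤ length w
  firstOcc-≤-length x []      = z≤n
  firstOcc-≤-length x (y ∷ w) with x ≟L y
  ... | yes _ = z≤n
  ... | no _  = s≤s (firstOcc-≤-length x w)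

  firstOcc-take : ∀ (x : Letter s) w c → firstOcc x w < c → firstOcc x (take c w) ≡ firstOcc x w
  firstOcc-take x []      (suc c) _ = refl
  firstOcc-take x (y ∷ w) (suc c) f<c with x ≟L y
  ... | yes _ = refl
  ... | no _  = cong suc (firstOcc-take x w c (≤-pred f<c))

pivot : ∀ {s} → Word s → ℕ → ℕ
pivot W i = firstOcc (λ′ i) W

-- the length of W(U) when |U| = m ≤ n
cut : ∀ {s} → ℕ → Word s → ℕ → ℕ
cut n W m = if m <ᵇ n then pivot W m else length W

module _ {s : ℕ} where

  cut-< : ∀ n (W : Word s) {m} → m < n → cut n W m ≡ pivot W m
  cut-< n W {m} m<n with m <ᵇ n | <⇒<ᵇ m<n
  ... | true | _ = refl

  cut-≥ : ∀ n (W : Word s) {m} → n ≤ m → cut n W m ≡ length W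
  cut-≥ n W {m} n≤m with m <ᵇ n | <ᵇ⇒< m n
  ... | false | _   = refl
  ... | true  | m<n = ⊥-elim (≤⇒≯ n≤m (m<n tt))

  cut-≤-length : ∀ n (W : Word s) m → cut n W m ≤ length W
  cut-≤-length n W m with m <ᵇ n
  ... | true  = firstOcc-≤-length _ W
  ... | false = ≤-refl

  apply≡map-take : ∀ n (W U : Word s) → apply n W U ≡ map (substL U) (take (cut n W (length U)) W)
  apply≡map-take n W U with length U <ᵇ n
  ... | true  = refl
  ... | false = cong (map (substL U)) (sym (take-all (length W) W ≤-refl))

  length-apply : ∀ n (W U : Word s) → length (apply n W U) ≡ cut n W (length U)
  length-apply n W U = begin
    length (apply n W U)                ≡⟨ cong length (apply≡map-take n W U) ⟩
    length (map (substL U) (take c W))  ≡⟨ length-map (substL U) (take c W) ⟩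
    length (take c W)                   ≡⟨ length-take c W ⟩
    c ⊓ length W                        ≡⟨ m≤n⇒m⊓n≡m (cut-≤-length n W (length U)) ⟩
    c                                   ∎
    where
    open ≡-Reasoning
    c = cut n W (length U)

  nth-apply : ∀ n (W U : Word s) r → r < length (apply n W U) →
              nth r (apply n W U) ≡ Maybe.map (substL U) (nth r W)
  nth-apply n W U r r<len = begin
    nth r (apply n W U)                       ≡⟨ cong (nth r) (apply≡map-take n W U) ⟩
    nth r (map (substL U) (take c W))         ≡⟨ nth-map (substL U) r (take c W) ⟩
    Maybe.map (substL U) (nth r (take c W))   ≡⟨ cong (Maybe.map (substL U)) (nth-take r c W r<c) ⟩
    Maybe.map (substL U) (nth r W)            ∎
    where
    open ≡-Reasoning
    c = cut n W (length U)
    r<c : r < c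
    r<c = subst (r <_) (length-apply n W U) r<len

  substL-λ : ∀ (U : Word s) i {v} → nth i U ≡ just v → substL U (λ′ i) ≡ v
  substL-λ U i e with nth i U | e
  ... | just _ | refl = refl

  substL-λ-< : ∀ (U : Word s) i → i < length U → just (substL U (λ′ i)) ≡ nth i U
  substL-λ-< U i i<m with nth-just i U i<m
  ... | v , e = trans (cong just (substL-λ U i e)) (sym e)

  substL-λ-cong : ∀ (U U′ : Word s) i i′ → i < length U → nth i′ U′ ≡ nth i U →
                  substL U′ (λ′ i′) ≡ substL U (λ′ i)
  substL-λ-cong U U′ i i′ i<m e with nth-just i U i<m
  ... | v , eᵢ = trans (substL-λ U′ i′ (trans e eᵢ)) (sym (substL-λ U i eᵢ))

module ParamWord {s n : ℕ} {W : Word s} (pw : IsParamWord n W) where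
  open IsParamWord pw

  pivot-nth : ∀ {i} → i < n → nth (pivot W i) W ≡ just (λ′ i)
  pivot-nth i<n = firstOcc-nth _ W (containsParams _ i<n)

  pivot-<-length : ∀ {i} → i < n → pivot W i < length W
  pivot-<-length i<n = nth-just⇒< _ W (pivot-nth i<n)

  pivot-strictMono : ∀ {i j} → i < j → j < n → pivot W i < pivot W j
  pivot-strictMono {i} {suc j} (s≤s i≤j) 1+j<n with m≤n⇒m<n∨m≡n i≤j
  ... | inj₁ i<j  = <-trans (pivot-strictMono i<j (<-trans (n<1+n j) 1+j<n))
                            (firstOccOrdered (suc j) (s≤s z≤n) 1+j<n)
  ... | inj₂ refl = firstOccOrdered (suc j) (s≤s z≤n) 1+j<n

  pivot-mono-≤ : ∀ {i j} → i ≤ j → j < n → pivot W i ≤ pivot W j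
  pivot-mono-≤ i≤j j<n with m≤n⇒m<n∨m≡n i≤j
  ... | inj₁ i<j  = <⇒≤ (pivot-strictMono i<j j<n)
  ... | inj₂ refl = ≤-refl

  pivot-cancel-< : ∀ {i j} → i < n → pivot W i < pivot W j → i < j
  pivot-cancel-< {i} {j} i<n pᵢ<pⱼ with <-cmp i j
  ... | tri< i<j _ _ = i<j
  ... | tri≈ _ refl _ = ⊥-elim (<-irrefl refl pᵢ<pⱼ)
  ... | tri> _ _ j<i = ⊥-elim (<-asym pᵢ<pⱼ (pivot-strictMono j<i i<n))

  param-bound : ∀ r {t} → nth r W ≡ just (λ′ t) → t < n × pivot W t ≤ r
  param-bound r e = onlyParamsBelowK _ (nth-just⇒∈ r W e) , firstOcc-minimal _ W r e

  pivot<cut : ∀ {i m} → i < m → m ≤ n → pivot W i < cut n W m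
  pivot<cut {i} {m} i<m m≤n with m≤n⇒m<n∨m≡n m≤n
  ... | inj₁ m<n  = subst (pivot W i <_) (sym (cut-< n W m<n)) (pivot-strictMono i<m m<n)
  ... | inj₂ refl = subst (pivot W i <_) (sym (cut-≥ n W ≤-refl)) (pivot-<-length i<m)

  cut-strictMono : ∀ {m m′} → m < m′ → m′ ≤ n → cut n W m < cut n W m′
  cut-strictMono {m} {m′} m<m′ m′≤n =
    subst (_< cut n W m′) (sym (cut-< n W (<-≤-trans m<m′ m′≤n))) (pivot<cut m<m′ m′≤n)

  cut-injective : ∀ {m m′} → m ≤ n → m′ ≤ n → cut n W m ≡ cut n W m′ → m ≡ m′
  cut-injective {m} {m′} m≤n m′≤n e with <-cmp m m′
  ... | tri< m<m′ _ _ = ⊥-elim (<-irrefl e (cut-strictMono m<m′ m′≤n))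
  ... | tri≈ _ m≡m′ _ = m≡m′
  ... | tri> _ _ m′<m = ⊥-elim (<-irrefl (sym e) (cut-strictMono m′<m m≤n))

  pivot<length-apply : ∀ (U : Word s) {i} → i < length U → length U ≤ n → pivot W i < length (apply n W U)
  pivot<length-apply U {i} i<m m≤n = subst (pivot W i <_) (sym (length-apply n W U)) (pivot<cut i<m m≤n)

  nth-apply-pivot : ∀ (U : Word s) {i} → i < length U → length U ≤ n →
                    nth (pivot W i) (apply n W U) ≡ nth i U
  nth-apply-pivot U {i} i<m m≤n = begin
    nth (pivot W i) (apply n W U)               ≡⟨ nth-apply n W U _ (pivot<length-apply U i<m m≤n) ⟩
    Maybe.map (substL U) (nth (pivot W i) W)    ≡⟨ cong (Maybe.map (substL U)) (pivot-nth (<-≤-trans i<m m≤n)) ⟩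
    just (substL U (λ′ i))                      ≡⟨ substL-λ-< U i i<m ⟩
    nth i U                                     ∎
    where open ≡-Reasoning

  param-in-apply : ∀ (U : Word s) r {t} → r < length (apply n W U) → length U ≤ n →
                   nth r W ≡ just (λ′ t) → t < length U
  param-in-apply U r {t} r<len m≤n e with t <? length U
  ... | yes t<m = t<m
  ... | no t≮m = ⊥-elim (<⇒≱ r<cut (≤-trans (pivot-mono-≤ m≤t t<n) pₜ≤r))
    where
    t<n  = proj₁ (param-bound r e)
    pₜ≤r = proj₂ (param-bound r e)
    m≤t  = ≮⇒≥ t≮m
    r<cut : r < pivot W (length U)
    r<cut = subst (r <_) (trans (length-apply n W U) (cut-< n W (≤-<-trans m≤t t<n))) r<len

  nth-apply-param : ∀ (U : Word s) r {t} → r < length (apply n W U) → length U ≤ n →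
                    nth r W ≡ just (λ′ t) → nth r (apply n W U) ≡ nth (pivot W t) (apply n W U)
  nth-apply-param U r {t} r<len m≤n e = begin
    nth r (apply n W U)             ≡⟨ nth-apply n W U r r<len ⟩
    Maybe.map (substL U) (nth r W)  ≡⟨ cong (Maybe.map (substL U)) e ⟩
    just (substL U (λ′ t))          ≡⟨ substL-λ-< U t t<m ⟩
    nth t U                         ≡⟨ sym (nth-apply-pivot U t<m m≤n) ⟩
    nth (pivot W t) (apply n W U)   ∎
    where
    open ≡-Reasoning
    t<m = param-in-apply U r r<len m≤n e

  cut-cong : ∀ (W′ : Word s) → (∀ {i} → i < n → pivot W i ≡ pivot W′ i) → length W ≡ length W′ →
             ∀ {m} → m ≤ n → cut n W m ≡ cut n W′ m
  cut-cong W′ pivots≡ len≡ {m} m≤n with m≤n⇒m<n∨m≡n m≤n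
  ... | inj₁ m<n  = trans (cut-< n W m<n) (trans (pivots≡ m<n) (sym (cut-< n W′ m<n)))
  ... | inj₂ refl = trans (cut-≥ n W ≤-refl) (trans len≡ (sym (cut-≥ n W′ ≤-refl)))

  cut≤pivot : ∀ {m′ m} → m′ ≤ m → m < n → cut n W m′ ≤ pivot W m
  cut≤pivot {m′} {m} m′≤m m<n with m≤n⇒m<n∨m≡n m′≤m
  ... | inj₁ m′<m = <⇒≤ (subst (cut n W m′ <_) (cut-< n W m<n) (cut-strictMono m′<m (<⇒≤ m<n)))
  ... | inj₂ refl = ≤-reflexive (cut-< n W m<n)

apply-injective : ∀ {s n} {W W′ U U′ : Word s} → IsParamWord n W → IsParamWord n W′ →
                  (∀ {i} → i < n → pivot W i ≡ pivot W′ i) → length W ≡ length W′ →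
                  length U ≤ n → length U′ ≤ n → apply n W U ≡ apply n W′ U′ → U ≡ U′
apply-injective {n = n} {W} {W′} {U} {U′} pw pw′ pivots≡ len≡ m≤n m′≤n e = nth-ext U U′ nth≡
  where
  module P  = ParamWord pw
  module P′ = ParamWord pw′
  length≡ : length U ≡ length U′
  length≡ = P.cut-injective m≤n m′≤n (begin
    cut n W (length U)     ≡⟨ sym (length-apply n W U) ⟩
    length (apply n W U)   ≡⟨ cong length e ⟩
    length (apply n W′ U′) ≡⟨ length-apply n W′ U′ ⟩
    cut n W′ (length U′)   ≡⟨ sym (P.cut-cong W′ pivots≡ len≡ m′≤n) ⟩
    cut n W (length U′)    ∎)
    where open ≡-Reasoning
  nth≡ : ∀ i → nth i U ≡ nth i U′
  nth≡ i with i <? length U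
  ... | no i≮m  = trans (nth-nothing i U (≮⇒≥ i≮m))
                        (sym (nth-nothing i U′ (subst (_≤ i) length≡ (≮⇒≥ i≮m))))
  ... | yes i<m = begin
    nth i U                          ≡⟨ sym (P.nth-apply-pivot U i<m m≤n) ⟩
    nth (pivot W i) (apply n W U)    ≡⟨ cong₂ nth (pivots≡ (<-≤-trans i<m m≤n)) e ⟩
    nth (pivot W′ i) (apply n W′ U′) ≡⟨ P′.nth-apply-pivot U′ (subst (i <_) length≡ i<m) m′≤n ⟩
    nth i U′                         ∎
    where open ≡-Reasoning

-- Envelopes with fewer parameters

module Prefix {s n : ℕ} {W : Word s} (pw : IsParamWord n W) {m : ℕ} (m<n : m < n) where
  open ParamWord pw

  W↾m : Word s
  W↾m = take (pivot W m) W

  pivot-prefix : ∀ {i} → i < m → pivot W↾m i ≡ pivot W i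
  pivot-prefix i<m = firstOcc-take _ W (pivot W m) (pivot-strictMono i<m m<n)

  isParamWord-prefix : IsParamWord m W↾m
  isParamWord-prefix = record
    { onlyParamsBelowK = onlyParamsBelow
    ; containsParams   = λ i i<m → nth-just⇒∈ _ W↾m
        (trans (nth-take _ (pivot W m) W (pivot-strictMono i<m m<n)) (pivot-nth (<-trans i<m m<n)))
    ; firstOccOrdered  = λ j 1≤j j<m →
        subst₂ _<_ (sym (pivot-prefix (≤-<-trans pred[n]≤n j<m))) (sym (pivot-prefix j<m))
          (IsParamWord.firstOccOrdered pw j 1≤j (<-trans j<m m<n))
    }
    where
    onlyParamsBelow : ∀ i → λ′ i ∈ W↾m → i < m
    onlyParamsBelow i i∈ with ∈⇒nth W↾m i∈
    ... | r , e with r <? pivot W m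
    ... | yes r<pₘ with param-bound r (trans (sym (nth-take r (pivot W m) W r<pₘ)) e)
    ...   | i<n , pᵢ≤r = pivot-cancel-< i<n (≤-<-trans pᵢ≤r r<pₘ)
    onlyParamsBelow i i∈ | r , e | no r≮pₘ with trans (sym (nth-take-≥ r (pivot W m) W (≮⇒≥ r≮pₘ))) e
    ... | ()

  cut-prefix : ∀ {m′} → m′ ≤ m → cut m W↾m m′ ≡ cut n W m′
  cut-prefix {m′} m′≤m with m≤n⇒m<n∨m≡n m′≤m
  ... | inj₁ m′<m = trans (cut-< m W↾m m′<m) (trans (pivot-prefix m′<m) (sym (cut-< n W (<-trans m′<m m<n))))
  ... | inj₂ refl = begin
    cut m W↾m m               ≡⟨ cut-≥ m W↾m ≤-refl ⟩
    length W↾m                ≡⟨ length-take (pivot W m) W ⟩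
    pivot W m ⊓ length W      ≡⟨ m≤n⇒m⊓n≡m (firstOcc-≤-length _ W) ⟩
    pivot W m                 ≡⟨ sym (cut-< n W m<n) ⟩
    cut n W m                 ∎
    where open ≡-Reasoning

  apply-prefix : ∀ (U : Word s) → length U ≤ m → apply m W↾m U ≡ apply n W U
  apply-prefix U m′≤m = begin
    apply m W↾m U                                     ≡⟨ apply≡map-take m W↾m U ⟩
    map (substL U) (take (cut m W↾m (length U)) W↾m) ≡⟨ cong (λ c′ → map (substL U) (take c′ W↾m)) (cut-prefix m′≤m) ⟩
    map (substL U) (take c W↾m)                       ≡⟨ cong (map (substL U)) (take-take c (pivot W m) W) ⟩
    map (substL U) (take (c ⊓ pivot W m) W)           ≡⟨ cong (λ c′ → map (substL U) (take c′ W)) c⊓pₘ≡c ⟩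
    map (substL U) (take c W)                         ≡⟨ sym (apply≡map-take n W U) ⟩
    apply n W U                                       ∎
    where
    open ≡-Reasoning
    c = cut n W (length U)
    c⊓pₘ≡c = m≤n⇒m⊓n≡m (cut≤pivot m′≤m m<n)

envelope-prefix : ∀ {s n₀} {W : Word s} {S} → Envelope (suc n₀) W S → (∀ {u} → u ∈ S → length u < length W) →
                  Envelope n₀ (take (pivot W n₀) W) S
envelope-prefix {n₀ = n₀} {W} {S} (pw , embeds) shorter = isParamWord-prefix , embed
  where
  open Prefix pw (n<1+n n₀)
  embed : ∀ u → u ∈ S → ∃ λ U → IsPW U × length U ≤ n₀ × apply n₀ W↾m U ≡ u
  embed u u∈ with embeds u u∈
  ... | U , pu , m≤1+n₀ , refl with m≤n⇒m<n∨m≡n m≤1+n₀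
  ...   | inj₁ m<1+n₀ = U , pu , ≤-pred m<1+n₀ , apply-prefix U (≤-pred m<1+n₀)
  ...   | inj₂ m≡1+n₀ = ⊥-elim (<-irrefl full (shorter u∈))
    where
    full : length (apply (suc n₀) W U) ≡ length W
    full = trans (length-apply (suc n₀) W U) (cut-≥ (suc n₀) W (≤-reflexive (sym m≡1+n₀)))

punchIn : ℕ → ℕ → ℕ
punchIn j t with t <? j
... | yes _ = t
... | no _  = suc t

punchOut : ℕ → ℕ → ℕ
punchOut j t with t <? j
... | yes _ = t
... | no _  = pred t

punchIn-< : ∀ {j t} → t < j → punchIn j t ≡ t
punchIn-< {j} {t} t<j with t <? j
... | yes _   = refl
... | no t≮j = ⊥-elim (t≮j t<j)

punchIn-≥ : ∀ {j t} → j ≤ t → punchIn j t ≡ suc t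
punchIn-≥ {j} {t} j≤t with t <? j
... | yes t<j = ⊥-elim (<⇒≱ t<j j≤t)
... | no _    = refl

punchIn≢ : ∀ j t → punchIn j t ≢ j
punchIn≢ j t with t <? j
... | yes t<j = <⇒≢ t<j
... | no t≮j  = t≮j ∘ ≤-reflexive

punchIn-suc : ∀ j t → punchIn (suc j) (suc t) ≡ suc (punchIn j t)
punchIn-suc j t with t <? j
... | yes t<j = punchIn-< (s≤s t<j)
... | no t≮j  = punchIn-≥ (s≤s (≮⇒≥ t≮j))

punchIn-strictMono : ∀ j {a b} → a < b → punchIn j a < punchIn j b
punchIn-strictMono j {a} {b} a<b with a <? j | b <? j
... | yes _   | yes _   = a<b
... | yes _   | no _    = <-trans a<b (n<1+n b)
... | no a≮j  | yes b<j = ⊥-elim (a≮j (<-trans a<b b<j))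
... | no _    | no _    = s≤s a<b

punchIn-cancel-< : ∀ j {a b} → punchIn j a < punchIn j b → a < b
punchIn-cancel-< j {a} {b} pa<pb with <-cmp a b
... | tri< a<b _ _ = a<b
... | tri≈ _ refl _ = ⊥-elim (<-irrefl refl pa<pb)
... | tri> _ _ b<a = ⊥-elim (<-asym pa<pb (punchIn-strictMono j b<a))

punchIn-cancel-≤ : ∀ j {a b} → punchIn j a ≤ punchIn j b → a ≤ b
punchIn-cancel-≤ j pa≤pb = ≮⇒≥ (λ b<a → <⇒≱ (punchIn-strictMono j b<a) pa≤pb)

punchIn-punchOut : ∀ {j t} → t ≢ j → punchIn j (punchOut j t) ≡ t
punchIn-punchOut {j} {t} t≢j with t <? j
... | yes t<j = punchIn-< t<j
punchIn-punchOut {j} {zero}  t≢j | no t≮j = ⊥-elim (t≢j (sym (n≤0⇒n≡0 (≮⇒≥ t≮j))))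
punchIn-punchOut {j} {suc t} t≢j | no t≮j = punchIn-≥ (≤-pred (≤∧≢⇒< (≮⇒≥ t≮j) (t≢j ∘ sym)))

punchOut-punchIn : ∀ j t → punchOut j (punchIn j t) ≡ t
punchOut-punchIn j t with t <? j
... | no t≮j with suc t <? j
...   | yes 1+t<j = ⊥-elim (t≮j (<-trans (n<1+n t) 1+t<j))
...   | no _      = refl
punchOut-punchIn j t | yes t<j with t <? j
...   | yes _   = refl
...   | no t≮j′ = ⊥-elim (t≮j′ t<j)

module _ {A : Set} where

  deleteAt : ℕ → List A → List A
  deleteAt j       []       = []
  deleteAt zero    (x ∷ xs) = xs
  deleteAt (suc j) (x ∷ xs) = x ∷ deleteAt j xs

  nth-deleteAt : ∀ j i (xs : List A) → nth i (deleteAt j xs) ≡ nth (punchIn j i) xs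
  nth-deleteAt j       i       []       with i <? j
  ... | yes _ = refl
  ... | no _  = refl
  nth-deleteAt zero    i       (x ∷ xs) rewrite punchIn-≥ {0} {i} z≤n = refl
  nth-deleteAt (suc j) zero    (x ∷ xs) rewrite punchIn-< {suc j} {0} (s≤s z≤n) = refl
  nth-deleteAt (suc j) (suc i) (x ∷ xs) rewrite punchIn-suc j i = nth-deleteAt j i xs

  punchIn-length-deleteAt : ∀ j (xs : List A) → length xs ≢ j → punchIn j (length (deleteAt j xs)) ≡ length xs
  punchIn-length-deleteAt j       []       0≢j = punchIn-< (n≢0⇒n>0 (0≢j ∘ sym))
  punchIn-length-deleteAt zero    (x ∷ xs) _   = punchIn-≥ z≤n
  punchIn-length-deleteAt (suc j) (x ∷ xs) n≢j = begin
    punchIn (suc j) (suc (length (deleteAt j xs))) ≡⟨ punchIn-suc j _ ⟩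
    suc (punchIn j (length (deleteAt j xs)))       ≡⟨ cong suc (punchIn-length-deleteAt j xs (n≢j ∘ cong suc)) ⟩
    suc (length xs)                                ∎
    where open ≡-Reasoning

isParamWord-deleteAt : ∀ {s k} {U : Word s} j → IsParamWord k U →
                       (∀ {t} → nth j U ≡ just (λ′ t) → ∃ λ i → i < j × nth i U ≡ just (λ′ t)) →
                       IsParamWord k (deleteAt j U)
isParamWord-deleteAt {k = k} {U} j pu notFirst = record
  { onlyParamsBelowK = λ t t∈ → onlyParamsBelowK t (∈-deleteAt t∈)
  ; containsParams   = λ t t<k → nth-just⇒∈ _ U′ (nth-pivot (containsParams t t<k))
  ; firstOccOrdered  = λ t 1≤t t<k →
      let t∈  = containsParams t t<k
          t′∈ = containsParams (pred t) (≤-<-trans pred[n]≤n t<k)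
      in subst₂ _<_ (sym (pivot-deleteAt t′∈)) (sym (pivot-deleteAt t∈))
           (punchIn-cancel-< j (subst₂ _<_ (sym (punchIn-punchOut (pivot≢j t′∈)))
                                           (sym (punchIn-punchOut (pivot≢j t∈)))
                                           (firstOccOrdered t 1≤t t<k)))
  }
  where
  open IsParamWord pu
  U′ = deleteAt j U

  pivot≢j : ∀ {t} → λ′ t ∈ U → pivot U t ≢ j
  pivot≢j {t} t∈ pₜ≡j with notFirst (subst (λ r → nth r U ≡ just (λ′ t)) pₜ≡j (firstOcc-nth _ U t∈))
  ... | i , i<j , eᵢ = <-irrefl pₜ≡j (≤-<-trans (firstOcc-minimal _ U i eᵢ) i<j)

  nth-pivot : ∀ {t} → λ′ t ∈ U → nth (punchOut j (pivot U t)) U′ ≡ just (λ′ t)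
  nth-pivot {t} t∈ = begin
    nth (punchOut j (pivot U t)) U′           ≡⟨ nth-deleteAt j _ U ⟩
    nth (punchIn j (punchOut j (pivot U t))) U ≡⟨ cong (λ r → nth r U) (punchIn-punchOut (pivot≢j t∈)) ⟩
    nth (pivot U t) U                          ≡⟨ firstOcc-nth _ U t∈ ⟩
    just (λ′ t)                                ∎
    where open ≡-Reasoning

  pivot-deleteAt : ∀ {t} → λ′ t ∈ U → pivot U′ t ≡ punchOut j (pivot U t)
  pivot-deleteAt {t} t∈ = firstOcc-unique _ U′ _ (nth-pivot t∈) earlier
    where
    earlier : ∀ q → q < punchOut j (pivot U t) → nth q U′ ≢ just (λ′ t)
    earlier q q< e = <⇒≱ (subst (punchIn j q <_) (punchIn-punchOut (pivot≢j t∈)) (punchIn-strictMono j q<))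
                         (firstOcc-minimal _ U (punchIn j q) (trans (sym (nth-deleteAt j q U)) e))

  ∈-deleteAt : ∀ {t} → λ′ t ∈ U′ → λ′ t ∈ U
  ∈-deleteAt t∈ with ∈⇒nth U′ t∈
  ... | q , e = nth-just⇒∈ _ U (trans (sym (nth-deleteAt j q U)) e)

data LetterOrBelow {s : ℕ} (j : ℕ) : Letter s → Set where
  letter : ∀ a → LetterOrBelow j (inj₁ a)
  param  : ∀ {i} → i < j → LetterOrBelow j (λ′ i)

LetterOrBelow-λ : ∀ {s j t} {c : Letter s} → LetterOrBelow j c → c ≡ λ′ t → t < j
LetterOrBelow-λ (param i<j) refl = i<j

collapse : ∀ {s} → ℕ → Letter s → Letter s → Letter s
collapse j c (inj₁ a) = inj₁ a
collapse j c (inj₂ t) with t ≟ j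
... | yes _ = c
... | no _  = λ′ (punchOut j t)

module _ {s : ℕ} (j : ℕ) (c : Letter s) where

  collapse-punchIn : ∀ t → collapse j c (λ′ (punchIn j t)) ≡ λ′ t
  collapse-punchIn t with punchIn j t ≟ j
  ... | yes p≡j = ⊥-elim (punchIn≢ j t p≡j)
  ... | no _    = cong λ′ (punchOut-punchIn j t)

  collapse≡λ⁻ : ∀ x {t} → collapse j c x ≡ λ′ t →
                x ≡ λ′ (punchIn j t) ⊎ (x ≡ λ′ j × c ≡ λ′ t)
  collapse≡λ⁻ (inj₂ t₀) e with t₀ ≟ j
  ... | yes refl = inj₂ (refl , e)
  collapse≡λ⁻ (inj₂ t₀) refl | no t₀≢j = inj₁ (cong λ′ (sym (punchIn-punchOut t₀≢j)))

-- the condition on U under which W(U) survives collapsing λ_j to c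
data Collapsible {s : ℕ} (j : ℕ) (c : Letter s) (U : Word s) : Set where
  endsBefore : length U < j → Collapsible j c U
  valueAt    : nth j U ≡ just (substL U c) → Collapsible j c U

module _ {s j : ℕ} {c : Letter s} {U : Word s} where

  collapsible-≢ : Collapsible j c U → length U ≢ j
  collapsible-≢ (endsBefore m<j) = <⇒≢ m<j
  collapsible-≢ (valueAt e)      = ≢-sym (<⇒≢ (nth-just⇒< j U e))

  collapsible-nth : Collapsible j c U → j < length U → nth j U ≡ just (substL U c)
  collapsible-nth (endsBefore m<j) j<m = ⊥-elim (<-asym j<m m<j)
  collapsible-nth (valueAt e)      _   = e

  collapsible-notFirst : Collapsible j c U → LetterOrBelow j c → ∀ {t} → nth j U ≡ just (λ′ t) →
                         ∃ λ i → i < j × nth i U ≡ just (λ′ t)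
  collapsible-notFirst col c-ok e with trans (sym (collapsible-nth col (nth-just⇒< j U e))) e
  collapsible-notFirst col (param {i} i<j) e | c≡λ =
    i , i<j , trans (sym (substL-λ-< U i (<-trans i<j (nth-just⇒< j U e)))) (cong just (just-injective c≡λ))

  substL-collapse : Collapsible j c U → LetterOrBelow j c → ∀ {t} → t < length U →
                    substL (deleteAt j U) (collapse j c (λ′ t)) ≡ substL U (λ′ t)
  substL-collapse col c-ok {t} t<m with t ≟ j
  ... | yes refl = trans (substL-c c-ok) (sym (substL-λ U j (collapsible-nth col t<m)))
    where
    substL-c : LetterOrBelow j c → substL (deleteAt j U) c ≡ substL U c
    substL-c (letter a)      = refl
    substL-c (param {i} i<j) = substL-λ-cong U (deleteAt j U) i i (<-trans i<j t<m)
                                 (trans (nth-deleteAt j i U) (cong (λ r → nth r U) (punchIn-< i<j)))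
  ... | no t≢j = substL-λ-cong U (deleteAt j U) t (punchOut j t) t<m
                   (trans (nth-deleteAt j _ U) (cong (λ r → nth r U) (punchIn-punchOut t≢j)))

module Collapse {s n₀ : ℕ} {W : Word s} (pw : IsParamWord (suc n₀) W) {j : ℕ} (j≤n₀ : j ≤ n₀)
                {c : Letter s} (c-ok : LetterOrBelow j c) where
  open ParamWord pw

  W′ : Word s
  W′ = map (collapse j c) W

  punchIn-bound : ∀ {t} → t < n₀ → punchIn j t < suc n₀
  punchIn-bound t<n₀ = subst (punchIn j _ <_) (punchIn-≥ j≤n₀) (punchIn-strictMono j t<n₀)

  punchIn-bound⁻ : ∀ {t} → punchIn j t < suc n₀ → t < n₀
  punchIn-bound⁻ p<n = punchIn-cancel-< j (subst (punchIn j _ <_) (sym (punchIn-≥ j≤n₀)) p<n)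

  nth-collapse-pivot : ∀ {t} → t < n₀ → nth (pivot W (punchIn j t)) W′ ≡ just (λ′ t)
  nth-collapse-pivot {t} t<n₀ = begin
    nth (pivot W (punchIn j t)) W′                           ≡⟨ nth-map (collapse j c) _ W ⟩
    Maybe.map (collapse j c) (nth (pivot W (punchIn j t)) W) ≡⟨ cong (Maybe.map (collapse j c)) pivot-nth′ ⟩
    just (collapse j c (λ′ (punchIn j t)))                   ≡⟨ cong just (collapse-punchIn j c t) ⟩
    just (λ′ t)                                              ∎
    where
    open ≡-Reasoning
    pivot-nth′ = pivot-nth (punchIn-bound t<n₀)

  pivot-collapse : ∀ {t} → t < n₀ → pivot W′ t ≡ pivot W (punchIn j t)
  pivot-collapse {t} t<n₀ = firstOcc-unique _ W′ _ (nth-collapse-pivot t<n₀) earlier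
    where
    earlier : ∀ q → q < pivot W (punchIn j t) → nth q W′ ≢ just (λ′ t)
    earlier q q<p e with nth-map-just⁻ (collapse j c) q W e
    ... | x , eₓ , cx≡λ with collapse≡λ⁻ j c x cx≡λ
    ... | inj₁ refl = <⇒≱ q<p (firstOcc-minimal _ W q eₓ)
    ... | inj₂ (refl , c≡λ) = <⇒≱ (<-trans q<p pₜ<pⱼ) (firstOcc-minimal _ W q eₓ)
      where
      t<j = LetterOrBelow-λ c-ok c≡λ
      pₜ<pⱼ : pivot W (punchIn j t) < pivot W j
      pₜ<pⱼ = subst (λ r → pivot W r < pivot W j) (sym (punchIn-< t<j)) (pivot-strictMono t<j (s≤s j≤n₀))

  isParamWord-collapse : IsParamWord n₀ W′
  isParamWord-collapse = record
    { onlyParamsBelowK = onlyParamsBelow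
    ; containsParams   = λ t t<n₀ → nth-just⇒∈ _ W′ (nth-collapse-pivot t<n₀)
    ; firstOccOrdered  = λ t 1≤t t<n₀ →
        subst₂ _<_ (sym (pivot-collapse (≤-<-trans pred[n]≤n t<n₀))) (sym (pivot-collapse t<n₀))
          (pivot-strictMono (punchIn-strictMono j (pred<self 1≤t)) (punchIn-bound t<n₀))
    }
    where
    pred<self : ∀ {t} → 1 ≤ t → pred t < t
    pred<self {suc t} _ = n<1+n t
    onlyParamsBelow : ∀ t → λ′ t ∈ W′ → t < n₀
    onlyParamsBelow t t∈ with ∈⇒nth W′ t∈
    ... | r , e with nth-map-just⁻ (collapse j c) r W e
    ... | x , eₓ , cx≡λ with collapse≡λ⁻ j c x cx≡λ
    ... | inj₁ refl         = punchIn-bound⁻ (proj₁ (param-bound r eₓ))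
    ... | inj₂ (_ , c≡λ)    = <-≤-trans (LetterOrBelow-λ c-ok c≡λ) j≤n₀

  cut-collapse : ∀ {m′} → m′ ≤ n₀ → cut n₀ W′ m′ ≡ cut (suc n₀) W (punchIn j m′)
  cut-collapse {m′} m′≤n₀ with m≤n⇒m<n∨m≡n m′≤n₀
  ... | inj₁ m′<n₀ = trans (cut-< n₀ W′ m′<n₀)
                       (trans (pivot-collapse m′<n₀) (sym (cut-< (suc n₀) W (punchIn-bound m′<n₀))))
  ... | inj₂ refl = begin
    cut n₀ W′ n₀                  ≡⟨ cut-≥ n₀ W′ ≤-refl ⟩
    length W′                     ≡⟨ length-map (collapse j c) W ⟩
    length W                      ≡⟨ sym (cut-≥ (suc n₀) W (≤-reflexive (sym (punchIn-≥ j≤n₀)))) ⟩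
    cut (suc n₀) W (punchIn j n₀) ∎
    where open ≡-Reasoning

  module _ (U : Word s) (m≤1+n₀ : length U ≤ suc n₀) (col : Collapsible j c U) where

    punchIn-length : punchIn j (length (deleteAt j U)) ≡ length U
    punchIn-length = punchIn-length-deleteAt j U (collapsible-≢ col)

    length-deleteAt-≤ : length (deleteAt j U) ≤ n₀
    length-deleteAt-≤ = punchIn-cancel-≤ j (subst₂ _≤_ (sym punchIn-length) (sym (punchIn-≥ j≤n₀)) m≤1+n₀)

    isPW-deleteAt : IsPW U → IsPW (deleteAt j U)
    isPW-deleteAt (k , pu) = k , isParamWord-deleteAt j pu (collapsible-notFirst col c-ok)

    apply-collapse : apply n₀ W′ (deleteAt j U) ≡ apply (suc n₀) W U
    apply-collapse = nth-ext _ _ nth≡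
      where
      U′ = deleteAt j U
      length≡ : length (apply n₀ W′ (deleteAt j U)) ≡ length (apply (suc n₀) W U)
      length≡ = begin
        length (apply n₀ W′ (deleteAt j U))           ≡⟨ length-apply n₀ W′ (deleteAt j U) ⟩
        cut n₀ W′ (length (deleteAt j U))             ≡⟨ cut-collapse length-deleteAt-≤ ⟩
        cut (suc n₀) W (punchIn j (length (deleteAt j U))) ≡⟨ cong (cut (suc n₀) W) punchIn-length ⟩
        cut (suc n₀) W (length U)                     ≡⟨ sym (length-apply (suc n₀) W U) ⟩
        length (apply (suc n₀) W U)                   ∎
        where open ≡-Reasoning
      nth≡ : ∀ r → nth r (apply n₀ W′ (deleteAt j U)) ≡ nth r (apply (suc n₀) W U)
      nth≡ r with r <? length (apply n₀ W′ (deleteAt j U))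
      ... | no r≮ = trans (nth-nothing r (apply n₀ W′ (deleteAt j U)) (≮⇒≥ r≮))
                          (sym (nth-nothing r (apply (suc n₀) W U) (subst (_≤ r) length≡ (≮⇒≥ r≮))))
      ... | yes r< = begin
        nth r (apply n₀ W′ U′)                              ≡⟨ nth-apply n₀ W′ U′ r r< ⟩
        Maybe.map (substL U′) (nth r W′)                    ≡⟨ cong (Maybe.map (substL U′)) (nth-map (collapse j c) r W) ⟩
        Maybe.map (substL U′) (Maybe.map (collapse j c) (nth r W)) ≡⟨ letterwise (nth r W) refl ⟩
        Maybe.map (substL U) (nth r W)                      ≡⟨ sym (nth-apply (suc n₀) W U r r<′) ⟩
        nth r (apply (suc n₀) W U)                          ∎
        where
        open ≡-Reasoning
        r<′ = subst (r <_) length≡ r<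
        letterwise : ∀ x? → nth r W ≡ x? →
                     Maybe.map (substL U′) (Maybe.map (collapse j c) x?) ≡ Maybe.map (substL U) x?
        letterwise nothing         _ = refl
        letterwise (just (inj₁ a)) _ = refl
        letterwise (just (inj₂ t)) e = cong just (substL-collapse col c-ok (param-in-apply U r r<′ m≤1+n₀ e))

envelope-collapse : ∀ {s n₀ j} {W : Word s} {S c} → Envelope (suc n₀) W S → j ≤ n₀ → LetterOrBelow j c →
                    (∀ U → length U ≤ suc n₀ → apply (suc n₀) W U ∈ S → Collapsible j c U) →
                    Envelope n₀ (map (collapse j c) W) S
envelope-collapse {n₀ = n₀} {j} {W} {S} (pw , embeds) j≤n₀ c-ok collapsible = isParamWord-collapse , embed
  where
  open Collapse pw j≤n₀ c-ok
  embed : ∀ u → u ∈ S → ∃ λ U′ → IsPW U′ × length U′ ≤ n₀ × apply n₀ W′ U′ ≡ u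
  embed u u∈ with embeds u u∈
  ... | U , pu , m≤ , refl =
    deleteAt j U , isPW-deleteAt U m≤ col pu , length-deleteAt-≤ U m≤ col , apply-collapse U m≤ col
    where col = collapsible U m≤ u∈

-- Forced positions

ConstantColumn : ∀ {s} → List (Word s) → ℕ → Set
ConstantColumn {s} S p = ∃ λ (a : Fin s) → ∀ {u} → u ∈ S → p < length u → nth p u ≡ just (inj₁ a)

SameColumns : ∀ {s} → List (Word s) → ℕ → ℕ → Set
SameColumns S q p = ∀ {u} → u ∈ S → p < length u → nth q u ≡ nth p u

data Forced {s : ℕ} (S : List (Word s)) (p : ℕ) : Set where
  truncation  : ∀ {u v} → u ∈ S → length u ≡ p → v ∈ S → p < length v → Forced S p
  freshColumn : ∀ {u} → u ∈ S → p < length u → ¬ ConstantColumn S p →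
                (∀ {q} → q < p → ¬ SameColumns S q p) → Forced S p

module _ {s n : ℕ} {W : Word s} {S : List (Word s)} (env : Envelope n W S) where
  open ParamWord (proj₁ env)

  envelope-length-≤ : ∀ {u} → u ∈ S → length u ≤ length W
  envelope-length-≤ {u} u∈ with proj₂ env u u∈
  ... | U , _ , _ , refl = subst (_≤ length W) (sym (length-apply n W U)) (cut-≤-length n W (length U))

  letter-column : ∀ {u r a} → u ∈ S → r < length u → nth r W ≡ just (inj₁ a) → nth r u ≡ just (inj₁ a)
  letter-column {u} {r} u∈ r<|u| e with proj₂ env u u∈
  ... | U , _ , _ , refl = trans (nth-apply n W U r r<|u|) (cong (Maybe.map (substL U)) e)

  param-column : ∀ {u r t} → u ∈ S → r < length u → nth r W ≡ just (λ′ t) → nth r u ≡ nth (pivot W t) u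
  param-column {u} {r} u∈ r<|u| e with proj₂ env u u∈
  ... | U , _ , m≤n , refl = nth-apply-param U r r<|u| m≤n e

  forced⇒pivot : ∀ {p} → Forced S p → ∃ λ j → j < n × pivot W j ≡ p
  forced⇒pivot {p} (truncation {u} {v} u∈ |u|≡p v∈ p<|v|) with proj₂ env u u∈
  ... | U , _ , m≤n , refl with m≤n⇒m<n∨m≡n m≤n
  ...   | inj₁ m<n = length U , m<n , trans (sym (cut-< n W m<n)) (trans (sym (length-apply n W U)) |u|≡p)
  ...   | inj₂ m≡n = ⊥-elim (<⇒≱ p<|v| (≤-trans (envelope-length-≤ v∈) (≤-reflexive |W|≡p)))
    where
    |W|≡p : length W ≡ p
    |W|≡p = trans (sym (cut-≥ n W (≤-reflexive (sym m≡n)))) (trans (sym (length-apply n W U)) |u|≡p)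
  forced⇒pivot {p} (freshColumn u∈ p<|u| nonConstant fresh)
    with nth-just p W (<-≤-trans p<|u| (envelope-length-≤ u∈))
  ... | inj₁ a , eₚ = ⊥-elim (nonConstant (a , λ v∈ p<|v| → letter-column v∈ p<|v| eₚ))
  ... | inj₂ t , eₚ with param-bound p eₚ
  ...   | t<n , pₜ≤p with m≤n⇒m<n∨m≡n pₜ≤p
  ...     | inj₂ pₜ≡p = t , t<n , pₜ≡p
  ...     | inj₁ pₜ<p = ⊥-elim (fresh pₜ<p λ v∈ p<|v| → sym (param-column v∈ p<|v| eₚ))

minimal-longest : ∀ {s n₀} {W : Word s} {S} → MinimalEnvelope (suc n₀) W S → ∃ λ u → u ∈ S × length u ≡ length W
minimal-longest {n₀ = n₀} {W} {S} (env , minimal) with any? (λ u → length u ≟ length W) S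
... | yes some = find some
... | no none  = ⊥-elim (1+n≰n (minimal n₀ _ (envelope-prefix env shorter)))
  where
  shorter : ∀ {u} → u ∈ S → length u < length W
  shorter u∈ = ≤∧≢⇒< (envelope-length-≤ env u∈) (none ∘ lose u∈)

pivot-forced : ∀ {s n j} {W : Word s} {S} → MinimalEnvelope n W S → j < n → ¬ ¬ Forced S (pivot W j)
pivot-forced {s} {suc n₀} {j} {W} {S} me@(env , minimal) j<n notForced =
  notForced (freshColumn uₗ∈ p<|uₗ| nonConstant fresh)
  where
  open ParamWord (proj₁ env)
  p = pivot W j
  uₗ : Word s
  uₗ = proj₁ (minimal-longest me)
  uₗ∈ : uₗ ∈ S
  uₗ∈ = proj₁ (proj₂ (minimal-longest me))
  p<|uₗ| : p < length uₗ
  p<|uₗ| = subst (p <_) (sym (proj₂ (proj₂ (minimal-longest me)))) (pivot-<-length j<n)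

  irreplaceable : ∀ {c} → LetterOrBelow j c →
                  (∀ U → length U ≤ suc n₀ → apply (suc n₀) W U ∈ S → j < length U →
                     nth p (apply (suc n₀) W U) ≡ just (substL U c)) → ⊥
  irreplaceable c-ok agrees = 1+n≰n (minimal n₀ _ (envelope-collapse env (≤-pred j<n) c-ok collapsible))
    where
    collapsible : ∀ U → length U ≤ suc n₀ → apply (suc n₀) W U ∈ S → Collapsible j _ U
    collapsible U m≤ u∈ with <-cmp (length U) j
    ... | tri< m<j _ _  = endsBefore m<j
    ... | tri≈ _ refl _ = ⊥-elim (notForced (truncation u∈ |u|≡p uₗ∈ p<|uₗ|))
      where |u|≡p = trans (length-apply (suc n₀) W U) (cut-< (suc n₀) W j<n)
    ... | tri> _ _ j<m  = valueAt (trans (sym (nth-apply-pivot U j<m m≤)) (agrees U m≤ u∈ j<m))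

  nonConstant : ¬ ConstantColumn S p
  nonConstant (a , constant) = irreplaceable (letter a) λ U m≤ u∈ j<m →
    constant u∈ (pivot<length-apply U j<m m≤)

  fresh : ∀ {q} → q < p → ¬ SameColumns S q p
  fresh {q} q<p same with nth-just q W (<-trans q<p (pivot-<-length j<n))
  ... | inj₁ b , e_q = nonConstant (b , λ u∈ p<|u| →
          trans (sym (same u∈ p<|u|)) (letter-column env u∈ (<-trans q<p p<|u|) e_q))
  ... | inj₂ i , e_q = irreplaceable (param i<j) λ U m≤ u∈ j<m →
          let p<|u| = pivot<length-apply U j<m m≤
              i<m   = <-trans i<j j<m
          in begin
            nth p (apply (suc n₀) W U)         ≡⟨ sym (same u∈ p<|u|) ⟩
            nth q (apply (suc n₀) W U)         ≡⟨ param-column env u∈ (<-trans q<p p<|u|) e_q ⟩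
            nth (pivot W i) (apply (suc n₀) W U) ≡⟨ nth-apply-pivot U i<m m≤ ⟩
            nth i U                            ≡⟨ sym (substL-λ-< U i i<m) ⟩
            just (substL U (λ′ i))             ∎
    where
    open ≡-Reasoning
    i<j : i < j
    i<j = pivot-cancel-< (proj₁ (param-bound q e_q)) (≤-<-trans (proj₂ (param-bound q e_q)) q<p)

-- Uniqueness of the embedding type

StrictMonoBelow : ℕ → (ℕ → ℕ) → Set
StrictMonoBelow n f = ∀ {i j} → i < j → j < n → f i < f j

ImageBelow-⊆ : ℕ → (ℕ → ℕ) → (ℕ → ℕ) → Set
ImageBelow-⊆ n f g = ∀ {i} → i < n → ∃ λ a → a < n × g a ≡ f i

sameImage-≤ : ∀ {n f g} → StrictMonoBelow n f → StrictMonoBelow n g → ImageBelow-⊆ n f g →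
              ∀ {i} → i < n → (∀ {i′} → i′ < i → f i′ ≡ g i′) → g i ≤ f i
sameImage-≤ {f = f} {g} f↑ g↑ f⊆g {i} i<n agree with f⊆g i<n
... | a , a<n , gₐ≡fᵢ with a <? i
...   | yes a<i = ⊥-elim (<-irrefl (trans (agree a<i) gₐ≡fᵢ) (f↑ a<i i<n))
...   | no a≮i with m≤n⇒m<n∨m≡n (≮⇒≥ a≮i)
...     | inj₁ i<a  = <⇒≤ (subst (g i <_) gₐ≡fᵢ (g↑ i<a a<n))
...     | inj₂ refl = ≤-reflexive gₐ≡fᵢ

strictMono-sameImage⇒≡ : ∀ {n f g} → StrictMonoBelow n f → StrictMonoBelow n g →
                          ImageBelow-⊆ n f g → ImageBelow-⊆ n g f → ∀ {i} → i < n → f i ≡ g i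
strictMono-sameImage⇒≡ {n} {f} {g} f↑ g↑ f⊆g g⊆f {i} i<n = agreeBelow (suc i) i<n (n<1+n i)
  where
  agreeBelow : ∀ i → i ≤ n → ∀ {i′} → i′ < i → f i′ ≡ g i′
  agreeBelow (suc i) 1+i≤n {i′} i′<1+i with m≤n⇒m<n∨m≡n (≤-pred i′<1+i)
  ... | inj₁ i′<i = agreeBelow i (<⇒≤ 1+i≤n) i′<i
  ... | inj₂ refl = ≤-antisym (sameImage-≤ g↑ f↑ g⊆f 1+i≤n (sym ∘ below))
                              (sameImage-≤ f↑ g↑ f⊆g 1+i≤n below)
    where
    below : ∀ {i″} → i″ < i → f i″ ≡ g i″
    below = agreeBelow i (<⇒≤ 1+i≤n)

minimal-pivot∈pivots : ∀ {s n n′ j} {W W′ : Word s} {S} → MinimalEnvelope n W S → Envelope n′ W′ S → j < n →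
                       ∃ λ a → a < n′ × pivot W′ a ≡ pivot W j
minimal-pivot∈pivots {n′ = n′} {j} {W} {W′} me env′ j<n =
  decidable-stable (anyUpTo? (λ a → pivot W′ a ≟ pivot W j) n′) (¬¬-map (forced⇒pivot env′) (pivot-forced me j<n))

minimal-pivots-agree : ∀ {s n i} {W W′ : Word s} {S} → MinimalEnvelope n W S → MinimalEnvelope n W′ S → i < n →
                       pivot W i ≡ pivot W′ i
minimal-pivots-agree me me′ = strictMono-sameImage⇒≡
  (ParamWord.pivot-strictMono (proj₁ (proj₁ me))) (ParamWord.pivot-strictMono (proj₁ (proj₁ me′)))
  (minimal-pivot∈pivots me (proj₁ me′)) (minimal-pivot∈pivots me′ (proj₁ me))

envelope₀-length : ∀ {s u} {W : Word s} {S} → Envelope 0 W S → u ∈ S → length u ≡ length W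
envelope₀-length {u = u} {W} (_ , embeds) u∈ with embeds u u∈
... | U , _ , _ , refl = trans (length-apply 0 W U) (cut-≥ 0 W {length U} z≤n)

minimal-lengths-agree : ∀ {s n u} {W W′ : Word s} {S} → MinimalEnvelope n W S → MinimalEnvelope n W′ S → u ∈ S →
                        length W ≡ length W′
minimal-lengths-agree {n = zero} me me′ u∈ =
  trans (sym (envelope₀-length (proj₁ me) u∈)) (envelope₀-length (proj₁ me′) u∈)
minimal-lengths-agree {s} {n = suc n₀} me me′ _ = ≤-antisym (longest-≤ me me′) (longest-≤ me′ me)
  where
  longest-≤ : ∀ {W W′ : Word s} {S} → MinimalEnvelope (suc n₀) W S → MinimalEnvelope (suc n₀) W′ S →
              length W ≤ length W′
  longest-≤ {W′ = W′} me me′ with minimal-longest me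
  ... | v , v∈ , |v|≡|W| = subst (_≤ length W′) |v|≡|W| (envelope-length-≤ (proj₁ me′) v∈)

embeddingType-⊆ : ∀ {s n} {W W′ : Word s} {S T T′} → MinimalEnvelope n W S → MinimalEnvelope n W′ S →
                  IsEmbType n W S T → IsEmbType n W′ S T′ → ∀ {U} → T U → T′ U
embeddingType-⊆ {T′ = T′} me me′ (T⊆ , T≡) (T′⊆ , T′≡) {U} tU
  with Equivalence.to (T′≡ _) (Equivalence.from (T≡ _) (U , tU , refl))
... | U′ , tU′ , e′ = subst T′ (sym U≡U′) tU′
  where
  u∈ = Equivalence.from (T≡ _) (U , tU , refl)
  U≡U′ : U ≡ U′
  U≡U′ = apply-injective (proj₁ (proj₁ me)) (proj₁ (proj₁ me′)) (minimal-pivots-agree me me′)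
           (minimal-lengths-agree me me′ u∈) (proj₂ (T⊆ U tU)) (proj₂ (T′⊆ U′ tU′)) (sym e′)

embeddingType-unique : ∀ {s n n′} {W W′ : Word s} {S T T′} → MinimalEnvelope n W S → MinimalEnvelope n′ W′ S →
                       IsEmbType n W S T → IsEmbType n′ W′ S T′ → ∀ U → T U ⇔ T′ U
embeddingType-unique me me′ τ τ′ U with ≤-antisym (proj₂ me _ _ (proj₁ me′)) (proj₂ me′ _ _ (proj₁ me))
... | refl = mk⇔ (embeddingType-⊆ me me′ τ τ′) (embeddingType-⊆ me′ me τ′ τ)

-- Finiteness of the set of embedding types

column : ∀ {s} → List (Word s) → ℕ → List (Maybe (Letter s))
column S p = map (nth p) S

map-≡⇒≡-∈ : ∀ {A B : Set} {f g : A → B} {xs x} → map f xs ≡ map g xs → x ∈ xs → f x ≡ g x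
map-≡⇒≡-∈ {xs = y ∷ xs} e (here refl) = ∷-injectiveˡ e
map-≡⇒≡-∈ {xs = y ∷ xs} e (there x∈)  = map-≡⇒≡-∈ (∷-injectiveʳ e) x∈

forced⇒newColumn : ∀ {s p q} {S : List (Word s)} → Forced S p → q < p → column S q ≢ column S p
forced⇒newColumn {p = p} {q} (truncation {u} u∈ |u|≡p _ _) q<p e
  with nth-just q u (subst (q <_) (sym |u|≡p) q<p)
... | x , e_q with trans (sym e_q) (trans (map-≡⇒≡-∈ e u∈) (nth-nothing p u (≤-reflexive |u|≡p)))
...   | ()
forced⇒newColumn (freshColumn _ _ _ fresh) q<p e = fresh q<p (λ u∈ _ → map-≡⇒≡-∈ e u∈)

minimal-columns-distinct : ∀ {s n i j} {W : Word s} {S} → MinimalEnvelope n W S → i < j → j < n →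
                           column S (pivot W i) ≢ column S (pivot W j)
minimal-columns-distinct me i<j j<n e = pivot-forced me j<n λ forced →
  forced⇒newColumn forced (ParamWord.pivot-strictMono (proj₁ (proj₁ me)) i<j j<n) e

distinct-∈⇒≤ : ∀ {A : Set} {n} {xs : List A} (f : ℕ → A) → (∀ {i j} → i < j → j < n → f i ≢ f j) →
               (∀ {i} → i < n → f i ∈ xs) → n ≤ length xs
distinct-∈⇒≤ {n = n} {xs} f distinct f∈ = injective⇒≤ position-injective
  where
  position : Fin n → Fin (length xs)
  position i = Any.index (f∈ (toℕ<n i))
  f-injective : ∀ {a b} → a < n → b < n → f a ≡ f b → a ≡ b
  f-injective {a} {b} a<n b<n e with <-cmp a b
  ... | tri< a<b _ _ = ⊥-elim (distinct a<b b<n e)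
  ... | tri≈ _ a≡b _ = a≡b
  ... | tri> _ _ b<a = ⊥-elim (distinct b<a a<n (sym e))
  position-injective : Injective _≡_ _≡_ position
  position-injective {i} {j} e = toℕ-injective (f-injective (toℕ<n i) (toℕ<n j)
    (trans (lookup-index (f∈ (toℕ<n i))) (trans (cong (lookup xs) e) (sym (lookup-index (f∈ (toℕ<n j)))))))

letters : (s k : ℕ) → List (Letter s)
letters s k = map inj₁ (allFin s) ++ map λ′ (upTo k)

letter∈letters : ∀ {s k x} {u : Word s} → IsParamWord k u → x ∈ u → x ∈ letters s k
letter∈letters {x = inj₁ a} _  _  = ∈-++⁺ˡ (∈-map⁺ inj₁ (∈-allFin a))
letter∈letters {x = inj₂ t} pu x∈ = ∈-++⁺ʳ _ (∈-map⁺ λ′ (∈-upTo⁺ (IsParamWord.onlyParamsBelowK pu t x∈)))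

listsOfLength : ∀ {A : Set} → ℕ → List A → List (List A)
listsOfLength zero    as = [] ∷ []
listsOfLength (suc m) as = cartesianProductWith _∷_ as (listsOfLength m as)

∈-listsOfLength : ∀ {A : Set} {as xs : List A} → All (_∈ as) xs → xs ∈ listsOfLength (length xs) as
∈-listsOfLength []          = here refl
∈-listsOfLength (x∈ ∷ xs∈) = ∈-cartesianProductWith⁺ _∷_ x∈ (∈-listsOfLength xs∈)

columnEntries : (s k : ℕ) → List (Maybe (Letter s))
columnEntries s k = nothing ∷ map just (letters s k)

column∈ : ∀ {s k ℓ p} {S : List (Word s)} → length S ≡ ℓ → All (IsParamWord k) S →
          column S p ∈ listsOfLength ℓ (columnEntries s k)
column∈ {s} {k} {p = p} {S} |S|≡ℓ S-k = subst (λ m → column S p ∈ listsOfLength m (columnEntries s k))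
  (trans (length-map (nth p) S) |S|≡ℓ) (∈-listsOfLength (map⁺ (All.map entry S-k)))
  where
  entry : ∀ {u} → IsParamWord k u → nth p u ∈ columnEntries s k
  entry {u} pu with nth p u in e
  ... | nothing = here refl
  ... | just x  = there (∈-map⁺ just (letter∈letters pu (nth-just⇒∈ p u e)))

maxParams : (s k ℓ : ℕ) → ℕ
maxParams s k ℓ = length (listsOfLength ℓ (columnEntries s k))

minimal-params-≤ : ∀ {s k ℓ n} {W : Word s} {S} → length S ≡ ℓ → All (IsParamWord k) S →
                   MinimalEnvelope n W S → n ≤ maxParams s k ℓ
minimal-params-≤ {W = W} {S} |S|≡ℓ S-k me =
  distinct-∈⇒≤ (column S ∘ pivot W) (minimal-columns-distinct me) (λ _ → column∈ |S|≡ℓ S-k)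

module EmbeddingList {s n : ℕ} {W : Word s} {S : List (Word s)} {T : Word s → Set}
                     (pw : IsParamWord n W) (τ : IsEmbType n W S T) where

  embeddingList : List (Word s)
  embeddingList = mapWith∈ S (λ u∈ → proj₁ (Equivalence.to (proj₂ τ _) u∈))

  ∈-embeddingList : ∀ U → T U ⇔ U ∈ embeddingList
  ∈-embeddingList U = mk⇔ to from
    where
    to : T U → U ∈ embeddingList
    to tU = mapWith∈⁺ _ (_ , u∈ , apply-injective pw pw (λ _ → refl) refl
                                    (proj₂ (proj₁ τ U tU)) (proj₂ (proj₁ τ _ tU″)) (sym e″))
      where
      u∈ = Equivalence.from (proj₂ τ _) (U , tU , refl)
      tU″ = proj₁ (proj₂ (Equivalence.to (proj₂ τ _) u∈))
      e″  = proj₂ (proj₂ (Equivalence.to (proj₂ τ _) u∈))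
    from : U ∈ embeddingList → T U
    from U∈ with mapWith∈⁻ S _ U∈
    ... | _ , u∈ , refl = proj₁ (proj₂ (Equivalence.to (proj₂ τ _) u∈))

  length-embeddingList : length embeddingList ≡ length S
  length-embeddingList = length-mapWith∈ (setoid (Word s)) S

  letters-embeddingList : ∀ {k} → All (IsParamWord k) S → ∀ {U x} → U ∈ embeddingList → x ∈ U → x ∈ letters s k
  letters-embeddingList S-k {U} U∈ x∈ with ∈⇒nth U x∈
  ... | i , eᵢ = letter∈letters (All.lookup S-k u∈)
                   (nth-just⇒∈ _ _ (trans (ParamWord.nth-apply-pivot pw U i<m m≤n) eᵢ))
    where
    tU  = Equivalence.from (∈-embeddingList U) U∈
    u∈  = Equivalence.from (proj₂ τ _) (U , tU , refl)
    m≤n = proj₂ (proj₁ τ U tU)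
    i<m = nth-just⇒< i U eᵢ

candidates : (s k ℓ : ℕ) → List (Word s)
candidates s k ℓ = concatMap (λ m → listsOfLength m (letters s k)) (upTo (suc (maxParams s k ℓ)))

embeddingTypes : (s k ℓ : ℕ) → List (List (Word s))
embeddingTypes s k ℓ = listsOfLength ℓ (candidates s k ℓ)

embeddingType-listed : ∀ {s k ℓ n} {W : Word s} {S T} → length S ≡ ℓ → All (IsParamWord k) S →
                       MinimalEnvelope n W S → IsEmbType n W S T →
                       Any (λ T₀ → ∀ U → T U ⇔ U ∈ T₀) (embeddingTypes s k ℓ)
embeddingType-listed {s} {k} {ℓ} |S|≡ℓ S-k me τ = lose listed ∈-embeddingList
  where
  open EmbeddingList (proj₁ (proj₁ me)) τ
  candidate : ∀ {U} → U ∈ embeddingList → U ∈ candidates s k ℓ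
  candidate {U} U∈ = ∈-concatMap⁺ (λ m → listsOfLength m (letters s k))
    (lose (∈-upTo⁺ (s≤s |U|≤max)) (∈-listsOfLength (All.tabulate (letters-embeddingList S-k U∈))))
    where
    |U|≤max = ≤-trans (proj₂ (proj₁ τ U (Equivalence.from (∈-embeddingList U) U∈)))
                      (minimal-params-≤ |S|≡ℓ S-k me)
  listed : embeddingList ∈ embeddingTypes s k ℓ
  listed = subst (λ m → embeddingList ∈ listsOfLength m (candidates s k ℓ)) (trans length-embeddingList |S|≡ℓ)
             (∈-listsOfLength (All.tabulate candidate))

corollary3p6 : (s k ℓ : ℕ) → 0 < k → 0 < ℓ →
    (Σ (List (List (Word s))) λ L →
       ∀ (S : List (Word s)) → Unique S → length S ≡ ℓ → All (IsParamWord k) S →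
       ∀ (n : ℕ) (W : Word s) → MinimalEnvelope n W S →
       ∀ (T : Word s → Set) → IsEmbType n W S T →
       Any (λ T₀ → ∀ U → T U ⇔ (U ∈ T₀)) L)
    ×
    (∀ (S : List (Word s)) → All (IsParamWord k) S →
       ∀ (n n′ : ℕ) (W W′ : Word s) → MinimalEnvelope n W S → MinimalEnvelope n′ W′ S →
       ∀ (T T′ : Word s → Set) → IsEmbType n W S T → IsEmbType n′ W′ S T′ →
       ∀ U → T U ⇔ T′ U)
corollary3p6 s k ℓ _ _ =
  (embeddingTypes s k ℓ , λ S _ |S|≡ℓ S-k n W me T τ → embeddingType-listed |S|≡ℓ S-k me τ) ,
  (λ S _ n n′ W W′ me me′ T T′ τ τ′ → embeddingType-unique me me′ τ τ′)
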